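{- Let $n\ge1$ and let $\mathcal{P}_n$ be the trivial unit interval positroid of rank $n$ on $[2n]$. Then every circuit $C$ of $\mathcal{P}_n$ is either of the form $\{1,\dots,n\}\cup\{i\}$ with $i\in\{n+1,\dots,2n\}$, or of the form $\{i,j\}$ with $i,j\in\{n+1,\dots,2n\}$ and $i\ne j$.
   Context: The trivial unit interval positroid $\mathcal{P}_n$ is the matroid on $[2n]=\{1,\dots,2n\}$ whose bases are the index sets of maximal linearly independent sets of columns of the real $n\times 2n$ matrix whose first $n$ columns form the identity matrix $I_n$ and each of whose columns $n+1,\dots,2n$ equals the vector with entry $(-1)^{n-i}$ in row $i$. A circuit is a minimal dependent subset of $[2n]$. -}

module Defs where

open import Data.Nat using (ℕ; zero; suc; _∸_; _<ᵇ_)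
open import Data.Nat as ℕ using ()
open import Data.Bool using (Bool; true; false; if_then_else_)
open import Data.Fin using (Fin; toℕ; zero; suc)
open import Data.Fin.Subset using (Subset; _∈_; _∉_; _⊂_)
open import Data.Vec using (tabulate)
open import Data.Rational using (ℚ; 0ℚ; 1ℚ; -_; _+_; _*_)
open import Data.Product using (Σ; ∃; _×_)
open import Relation.Binary.PropositionalEquality using (_≡_; _≢_)
open import Relation.Nullary using (¬_)

∑ : ∀ {m} → (Fin m → ℚ) → ℚ
∑ {zero}  f = 0ℚ
∑ {suc m} f = f zero + ∑ (λ k → f (suc k))

signPow : ℕ → ℚ
signPow zero          = 1ℚ
signPow (suc zero)    = - 1ℚ
signPow (suc (suc e)) = signPow e

-- The n × 2n real (here rational; all entries are 0, ±1) matrix defining P_n.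
-- Rows r = 0..n-1 correspond to i = r+1, columns j = 0..2n-1 to j+1.
-- Columns 0..n-1 : identity I_n; columns n..2n-1 : entry (-1)^(n-i) = (-1)^(n-1-r) in row r.
matP : (n : ℕ) → Fin n → Fin (n ℕ.+ n) → ℚ
matP n r j =
  if toℕ j <ᵇ n
  then (if toℕ r ℕ.≡ᵇ toℕ j then 1ℚ else 0ℚ)
  else signPow (n ∸ suc (toℕ r))

Dependent : (n : ℕ) → Subset (n ℕ.+ n) → Set
Dependent n S =
  Σ (Fin (n ℕ.+ n) → ℚ) λ c →
    (∀ j → j ∉ S → c j ≡ 0ℚ) ×
    (∃ λ j → c j ≢ 0ℚ) ×
    (∀ r → ∑ (λ j → c j * matP n r j) ≡ 0ℚ)

Independent : (n : ℕ) → Subset (n ℕ.+ n) → Set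
Independent n S = ¬ Dependent n S

Circuit : (n : ℕ) → Subset (n ℕ.+ n) → Set
Circuit n C = Dependent n C × (∀ D → D ⊂ C → Independent n D)

firstHalf : (n : ℕ) → Subset (n ℕ.+ n)
firstHalf n = tabulate (λ k → toℕ k <ᵇ n)

-- The last n columns of the matrix are one and the same vector v with entries ±1. If c is a
-- relation among the columns and s is the sum of its last n coefficients, row r reads
-- c_r + s v_r = 0. If s = 0, the first n coefficients vanish and the support contains two
-- of the equal columns, which already form a dependent pair; minimality makes the circuit
-- that pair. If s ≠ 0, every one of the first n coefficients is nonzero, and the support
-- meets the last n columns; it meets them only once, since two of them would again form a
-- dependent pair, now strictly inside the circuit.
module Submission where

open import Defs
open import Data.Nat using (ℕ; _≤_; _+_)
open import Data.Fin using (Fin; toℕ)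
open import Data.Fin.Subset using (Subset; _∪_; ⁅_⁆)
open import Data.Product using (∃; ∃₂; _×_)
open import Data.Sum using (_⊎_)
open import Relation.Binary.PropositionalEquality using (_≡_; _≢_)

open import Algebra.Bundles using (CommutativeRing)
open import Data.Nat using (zero; suc; _<_; _∸_; _≡ᵇ_; _<ᵇ_)
open import Data.Bool using (true; false; if_then_else_)
import Data.Bool.Properties as Boolᵖ
open import Data.Fin using (zero; suc; _↑ˡ_; _↑ʳ_; splitAt; fromℕ<; punchIn)
import Data.Fin.Properties as Finᵖ
open import Data.Fin.Subset using (_∈_; _∉_; _⊆_)
open import Data.Fin.Subset.Properties using (_∈?_; ⊆-antisym; x∈⁅x⁆; x∈⁅y⁆⇒x≡y; x∈p∪q⁺; x∈p∪q⁻)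
import Data.Nat.Properties as ℕᵖ
open import Data.Product using (_,_; proj₁; proj₂)
open import Data.Rational using (ℚ; 0ℚ; 1ℚ; -_; _*_) renaming (_+_ to _+ℚ_)
import Data.Rational.Properties as ℚᵖ
open import Data.Sum using (inj₁; inj₂; [_,_]′)
open import Data.Vec using (lookup)
import Data.Vec.Properties as Vecᵖ
open import Function using (_∘_; Equivalence)
open import Relation.Binary.PropositionalEquality using (refl; sym; trans; cong; cong₂; subst; module ≡-Reasoning)
open import Relation.Nullary using (yes; no; contradiction)

open import Algebra.Properties.Semiring.Sum (CommutativeRing.semiring ℚᵖ.+-*-commutativeRing)
  using (sum; sum-cong-≗; sum-replicate-zero; sum-remove; ∑-distrib-+; *-distribˡ-sum; *-distribʳ-sum)
open import Algebra.Properties.Ring ℚᵖ.+-*-ring using (-1*x≈-x)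

∑≡sum : ∀ {m} (f : Fin m → ℚ) → ∑ f ≡ sum f
∑≡sum {zero}  f = refl
∑≡sum {suc m} f = cong (f zero +ℚ_) (∑≡sum (f ∘ suc))

sum-↑ : ∀ m {k} (f : Fin (m + k) → ℚ) → sum f ≡ sum (f ∘ (_↑ˡ k)) +ℚ sum (f ∘ (m ↑ʳ_))
sum-↑ zero    f = sym (ℚᵖ.+-identityˡ (sum f))
sum-↑ (suc m) f = trans (cong (f zero +ℚ_) (sum-↑ m (f ∘ suc))) (sym (ℚᵖ.+-assoc (f zero) _ _))

sum-zero : ∀ {m} {f : Fin m → ℚ} → (∀ k → f k ≡ 0ℚ) → sum f ≡ 0ℚ
sum-zero {m} f≗0 = trans (sum-cong-≗ f≗0) (sum-replicate-zero m)

sum≢0⇒∃≢0 : ∀ {m} (f : Fin m → ℚ) → sum f ≢ 0ℚ → ∃ λ k → f k ≢ 0ℚ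
sum≢0⇒∃≢0 {m} f sum≢0 = Finᵖ.¬∀⟶∃¬ m _ (λ k → f k ℚᵖ.≟ 0ℚ) (sum≢0 ∘ sum-zero)

sum≡0⇒∃≢0-elsewhere : ∀ {m} (f : Fin m → ℚ) {i} → sum f ≡ 0ℚ → f i ≢ 0ℚ →
  ∃ λ j → j ≢ i × f j ≢ 0ℚ
sum≡0⇒∃≢0-elsewhere {suc m} f {i} sum≡0 fi≢0
  with sum≢0⇒∃≢0 (f ∘ punchIn i) rest≢0
  where
  rest≢0 : sum (f ∘ punchIn i) ≢ 0ℚ
  rest≢0 rest≡0 = fi≢0 (begin
    f i                            ≡⟨ ℚᵖ.+-identityʳ (f i) ⟨
    f i +ℚ 0ℚ                      ≡⟨ cong (f i +ℚ_) rest≡0 ⟨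
    f i +ℚ sum (f ∘ punchIn i)     ≡⟨ sum-remove f ⟨
    sum f                          ≡⟨ sum≡0 ⟩
    0ℚ                             ∎)
    where open ≡-Reasoning
... | j , fj≢0 = punchIn i j , Finᵖ.punchInᵢ≢i i j , fj≢0

-- Written with toℕ and _≡ᵇ_ exactly as in the identity block of matP, so that the two
-- agree by computation.
δ : ∀ {m} → Fin m → Fin m → ℚ
δ i j = if toℕ i ≡ᵇ toℕ j then 1ℚ else 0ℚ

δ-refl : ∀ {m} (i : Fin m) → δ i i ≡ 1ℚ
δ-refl zero    = refl
δ-refl (suc i) = δ-refl i

δ-≢ : ∀ {m} {i j : Fin m} → i ≢ j → δ i j ≡ 0ℚ
δ-≢ {i = zero}  {zero}  i≢j = contradiction refl i≢j
δ-≢ {i = zero}  {suc j} i≢j = refl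
δ-≢ {i = suc i} {zero}  i≢j = refl
δ-≢ {i = suc i} {suc j} i≢j = δ-≢ (i≢j ∘ cong suc)

sum-*δ : ∀ {m} (f : Fin m → ℚ) (i : Fin m) → sum (λ j → f j * δ i j) ≡ f i
sum-*δ f zero = begin
  f zero * 1ℚ +ℚ sum (λ j → f (suc j) * 0ℚ)
    ≡⟨ cong₂ _+ℚ_ (ℚᵖ.*-identityʳ (f zero)) (sum-zero (ℚᵖ.*-zeroʳ ∘ f ∘ suc)) ⟩
  f zero +ℚ 0ℚ
    ≡⟨ ℚᵖ.+-identityʳ (f zero) ⟩
  f zero
    ∎
  where open ≡-Reasoning
sum-*δ f (suc i) = begin
  f zero * 0ℚ +ℚ sum (λ j → f (suc j) * δ i j)
    ≡⟨ cong₂ _+ℚ_ (ℚᵖ.*-zeroʳ (f zero)) (sum-*δ (f ∘ suc) i) ⟩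
  0ℚ +ℚ f (suc i)
    ≡⟨ ℚᵖ.+-identityˡ (f (suc i)) ⟩
  f (suc i)
    ∎
  where open ≡-Reasoning

sum-neg : ∀ {m} (f : Fin m → ℚ) → sum (λ k → - f k) ≡ - sum f
sum-neg f = begin
  sum (λ k → - f k)      ≡⟨ sum-cong-≗ (sym ∘ -1*x≈-x ∘ f) ⟩
  sum (λ k → - 1ℚ * f k) ≡⟨ *-distribˡ-sum (- 1ℚ) f ⟨
  - 1ℚ * sum f           ≡⟨ -1*x≈-x (sum f) ⟩
  - sum f                ∎
  where open ≡-Reasoning

sum-[δ-δ]* : ∀ {m} (i j : Fin m) (g : Fin m → ℚ) →
  sum (λ x → (δ i x +ℚ - δ j x) * g x) ≡ g i +ℚ - g j
sum-[δ-δ]* i j g = begin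
  sum (λ x → (δ i x +ℚ - δ j x) * g x)       ≡⟨ sum-cong-≗ expand ⟩
  sum (λ x → g x * δ i x +ℚ - (g x * δ j x)) ≡⟨ ∑-distrib-+ (λ x → g x * δ i x) _ ⟩
  sum (λ x → g x * δ i x) +ℚ sum (λ x → - (g x * δ j x))
    ≡⟨ cong₂ _+ℚ_ (sum-*δ g i) (trans (sum-neg (λ x → g x * δ j x)) (cong -_ (sum-*δ g j))) ⟩
  g i +ℚ - g j                               ∎
  where
  open ≡-Reasoning
  expand : ∀ x → (δ i x +ℚ - δ j x) * g x ≡ g x * δ i x +ℚ - (g x * δ j x)
  expand x = begin
    (δ i x +ℚ - δ j x) * g x         ≡⟨ ℚᵖ.*-comm _ (g x) ⟩
    g x * (δ i x +ℚ - δ j x)         ≡⟨ ℚᵖ.*-distribˡ-+ (g x) (δ i x) (- δ j x) ⟩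
    g x * δ i x +ℚ g x * - δ j x     ≡⟨ cong (g x * δ i x +ℚ_) (ℚᵖ.neg-distribʳ-* (g x) (δ j x)) ⟨
    g x * δ i x +ℚ - (g x * δ j x)   ∎

<ᵇ-true : ∀ {m n} → m < n → (m <ᵇ n) ≡ true
<ᵇ-true = Equivalence.to Boolᵖ.T-≡ ∘ ℕᵖ.<⇒<ᵇ

<ᵇ-false : ∀ {m n} → n ≤ m → (m <ᵇ n) ≡ false
<ᵇ-false {m} {n} n≤m with m <ᵇ n | ℕᵖ.<ᵇ⇒< m n
... | false | _   = refl
... | true  | m<n = contradiction (m<n _) (ℕᵖ.≤⇒≯ n≤m)

n≤toℕ-↑ʳ : ∀ n {m} (k : Fin m) → n ≤ toℕ (n ↑ʳ k)
n≤toℕ-↑ʳ n k = subst (n ≤_) (sym (Finᵖ.toℕ-↑ʳ n k)) (ℕᵖ.m≤m+n n (toℕ k))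

↑ˡ≢↑ʳ : ∀ {m n} (i : Fin m) (j : Fin n) → i ↑ˡ n ≢ m ↑ʳ j
↑ˡ≢↑ʳ {m} {n} i j i≡j = ℕᵖ.<⇒≱ toℕ[i]<m (subst (m ≤_) (cong toℕ (sym i≡j)) (n≤toℕ-↑ʳ m j))
  where
  toℕ[i]<m : toℕ (i ↑ˡ n) < m
  toℕ[i]<m = subst (_< m) (sym (Finᵖ.toℕ-↑ˡ i n)) (Finᵖ.toℕ<n i)

signColumn : (n : ℕ) → Fin n → ℚ
signColumn n r = signPow (n ∸ suc (toℕ r))

matP-↑ˡ : ∀ n (r k : Fin n) → matP n r (k ↑ˡ n) ≡ δ r k
matP-↑ˡ n r k rewrite Finᵖ.toℕ-↑ˡ k n | <ᵇ-true (Finᵖ.toℕ<n k) = refl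

matP-↑ʳ : ∀ n (r k : Fin n) → matP n r (n ↑ʳ k) ≡ signColumn n r
matP-↑ʳ n r k rewrite <ᵇ-false (n≤toℕ-↑ʳ n k) = refl

rightSum : ∀ n → (Fin (n + n) → ℚ) → ℚ
rightSum n c = sum (c ∘ (n ↑ʳ_))

rowSum : ∀ n (c : Fin (n + n) → ℚ) (r : Fin n) →
  ∑ (λ j → c j * matP n r j) ≡ c (r ↑ˡ n) +ℚ rightSum n c * signColumn n r
rowSum n c r = begin
  ∑ (λ j → c j * matP n r j)
    ≡⟨ ∑≡sum (λ j → c j * matP n r j) ⟩
  sum (λ j → c j * matP n r j)
    ≡⟨ sum-↑ n (λ j → c j * matP n r j) ⟩
  sum (λ k → c (k ↑ˡ n) * matP n r (k ↑ˡ n)) +ℚ sum (λ k → c (n ↑ʳ k) * matP n r (n ↑ʳ k))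
    ≡⟨ cong₂ _+ℚ_ (sum-cong-≗ (cong (c (_ ↑ˡ n) *_) ∘ matP-↑ˡ n r))
                  (sum-cong-≗ (cong (c (n ↑ʳ _) *_) ∘ matP-↑ʳ n r)) ⟩
  sum (λ k → c (k ↑ˡ n) * δ r k) +ℚ sum (λ k → c (n ↑ʳ k) * signColumn n r)
    ≡⟨ cong₂ _+ℚ_ (sum-*δ (c ∘ (_↑ˡ n)) r) (sym (*-distribʳ-sum (signColumn n r) (c ∘ (n ↑ʳ_)))) ⟩
  c (r ↑ˡ n) +ℚ rightSum n c * signColumn n r
    ∎
  where open ≡-Reasoning

signPow²≡1 : ∀ e → signPow e * signPow e ≡ 1ℚ
signPow²≡1 zero          = refl
signPow²≡1 (suc zero)    = refl
signPow²≡1 (suc (suc e)) = signPow²≡1 e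

*signPow≡0⇒≡0 : ∀ {x} e → x * signPow e ≡ 0ℚ → x ≡ 0ℚ
*signPow≡0⇒≡0 {x} e x*σ≡0 = begin
  x                           ≡⟨ ℚᵖ.*-identityʳ x ⟨
  x * 1ℚ                      ≡⟨ cong (x *_) (signPow²≡1 e) ⟨
  x * (signPow e * signPow e) ≡⟨ ℚᵖ.*-assoc x _ _ ⟨
  x * signPow e * signPow e   ≡⟨ cong (_* signPow e) x*σ≡0 ⟩
  0ℚ * signPow e              ≡⟨ ℚᵖ.*-zeroˡ (signPow e) ⟩
  0ℚ                          ∎
  where open ≡-Reasoning

⁅⁆-⊆ : ∀ {m} {x : Fin m} {p : Subset m} → x ∈ p → ⁅ x ⁆ ⊆ p
⁅⁆-⊆ {x = x} x∈p y∈⁅x⁆ rewrite x∈⁅y⁆⇒x≡y x y∈⁅x⁆ = x∈p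

∪-⊆ : ∀ {m} {p q r : Subset m} → p ⊆ r → q ⊆ r → p ∪ q ⊆ r
∪-⊆ {p = p} {q} p⊆r q⊆r x∈p∪q = [ p⊆r , q⊆r ]′ (x∈p∪q⁻ p q x∈p∪q)

∉-⁅⁆∪⁅⁆ˡ : ∀ {m} {i j x : Fin m} → x ∉ ⁅ i ⁆ ∪ ⁅ j ⁆ → i ≢ x
∉-⁅⁆∪⁅⁆ˡ x∉ refl = x∉ (x∈p∪q⁺ (inj₁ (x∈⁅x⁆ _)))

∉-⁅⁆∪⁅⁆ʳ : ∀ {m} {i j x : Fin m} → x ∉ ⁅ i ⁆ ∪ ⁅ j ⁆ → j ≢ x
∉-⁅⁆∪⁅⁆ʳ x∉ refl = x∉ (x∈p∪q⁺ (inj₂ (x∈⁅x⁆ _)))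

nonzero⇒∈ : ∀ {m} {S : Subset m} {c : Fin m → ℚ} →
  (∀ j → j ∉ S → c j ≡ 0ℚ) → ∀ {x} → c x ≢ 0ℚ → x ∈ S
nonzero⇒∈ {S = S} outside {x} cx≢0 with x ∈? S
... | yes x∈S = x∈S
... | no  x∉S = contradiction (outside x x∉S) cx≢0

equalColumns-dependent : ∀ n {i j : Fin (n + n)} → i ≢ j →
  (∀ r → matP n r i ≡ matP n r j) → Dependent n (⁅ i ⁆ ∪ ⁅ j ⁆)
equalColumns-dependent n {i} {j} i≢j columns≡ = c , outside , (i , c[i]≢0) , rows
  where
  c : Fin (n + n) → ℚ
  c x = δ i x +ℚ - δ j x
  outside : ∀ x → x ∉ ⁅ i ⁆ ∪ ⁅ j ⁆ → c x ≡ 0ℚ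
  outside x x∉ rewrite δ-≢ (∉-⁅⁆∪⁅⁆ˡ x∉) | δ-≢ (∉-⁅⁆∪⁅⁆ʳ x∉) = refl
  c[i]≢0 : c i ≢ 0ℚ
  c[i]≢0 rewrite δ-refl i | δ-≢ (i≢j ∘ sym) = ℚᵖ.1≢0
  rows : ∀ r → ∑ (λ x → c x * matP n r x) ≡ 0ℚ
  rows r = begin
    ∑ (λ x → c x * matP n r x)   ≡⟨ ∑≡sum (λ x → c x * matP n r x) ⟩
    sum (λ x → c x * matP n r x) ≡⟨ sum-[δ-δ]* i j (matP n r) ⟩
    matP n r i +ℚ - matP n r j   ≡⟨ cong (_+ℚ - matP n r j) (columns≡ r) ⟩
    matP n r j +ℚ - matP n r j   ≡⟨ ℚᵖ.+-inverseʳ (matP n r j) ⟩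
    0ℚ                           ∎
    where open ≡-Reasoning

dependent⊆circuit⇒⊇ : ∀ {n} {C D : Subset (n + n)} → Circuit n C → D ⊆ C → Dependent n D → C ⊆ D
dependent⊆circuit⇒⊇ {D = D} (_ , minimal) D⊆C D-dependent {x} x∈C with x ∈? D
... | yes x∈D = x∈D
... | no  x∉D = contradiction D-dependent (minimal D (D⊆C , x , x∈C , x∉D))

circuit⊇rightPair⇒≡ : ∀ {n} {C : Subset (n + n)} → Circuit n C → ∀ {a b} → a ≢ b →
  n ↑ʳ a ∈ C → n ↑ʳ b ∈ C → C ≡ ⁅ n ↑ʳ a ⁆ ∪ ⁅ n ↑ʳ b ⁆
circuit⊇rightPair⇒≡ {n} {C} circuit {a} {b} a≢b a∈C b∈C =
  ⊆-antisym (dependent⊆circuit⇒⊇ circuit pair⊆C pair-dependent) pair⊆C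
  where
  pair⊆C : ⁅ n ↑ʳ a ⁆ ∪ ⁅ n ↑ʳ b ⁆ ⊆ C
  pair⊆C = ∪-⊆ (⁅⁆-⊆ a∈C) (⁅⁆-⊆ b∈C)
  pair-dependent : Dependent n (⁅ n ↑ʳ a ⁆ ∪ ⁅ n ↑ʳ b ⁆)
  pair-dependent = equalColumns-dependent n (a≢b ∘ Finᵖ.↑ʳ-injective n a b)
    (λ r → trans (matP-↑ʳ n r a) (sym (matP-↑ʳ n r b)))

data Split m k : Fin (m + k) → Set where
  left  : (i : Fin m) → Split m k (i ↑ˡ k)
  right : (j : Fin k) → Split m k (m ↑ʳ j)

split : ∀ m {k} (x : Fin (m + k)) → Split m k x
split m x with splitAt m x in eq
... | inj₁ i = subst (Split m _) (Finᵖ.splitAt⁻¹-↑ˡ eq) (left i)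
... | inj₂ j = subst (Split m _) (Finᵖ.splitAt⁻¹-↑ʳ eq) (right j)

↑ˡ∈firstHalf : ∀ n (r : Fin n) → r ↑ˡ n ∈ firstHalf n
↑ˡ∈firstHalf n r = Vecᵖ.lookup⇒[]= (r ↑ˡ n) (firstHalf n) (begin
  lookup (firstHalf n) (r ↑ˡ n) ≡⟨ Vecᵖ.lookup∘tabulate _ (r ↑ˡ n) ⟩
  toℕ (r ↑ˡ n) <ᵇ n             ≡⟨ cong (_<ᵇ n) (Finᵖ.toℕ-↑ˡ r n) ⟩
  toℕ r <ᵇ n                    ≡⟨ <ᵇ-true (Finᵖ.toℕ<n r) ⟩
  true                          ∎)
  where open ≡-Reasoning

↑ʳ∉firstHalf : ∀ n (k : Fin n) → n ↑ʳ k ∉ firstHalf n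
↑ʳ∉firstHalf n k k∈ with trans (sym (Vecᵖ.[]=⇒lookup k∈))
  (trans (Vecᵖ.lookup∘tabulate _ (n ↑ʳ k)) (<ᵇ-false (n≤toℕ-↑ʳ n k)))
... | ()

↑ˡ∉⁅↑ʳ⁆∪⁅↑ʳ⁆ : ∀ {m n} (i : Fin m) (a b : Fin n) → i ↑ˡ n ∉ ⁅ m ↑ʳ a ⁆ ∪ ⁅ m ↑ʳ b ⁆
↑ˡ∉⁅↑ʳ⁆∪⁅↑ʳ⁆ i a b i∈ = [ ↑ˡ≢↑ʳ i a ∘ x∈⁅y⁆⇒x≡y _ , ↑ˡ≢↑ʳ i b ∘ x∈⁅y⁆⇒x≡y _ ]′ (x∈p∪q⁻ _ _ i∈)

module _ {n} {C : Subset (n + n)} (circuit : Circuit n C) where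

  private
    c : Fin (n + n) → ℚ
    c = proj₁ (proj₁ circuit)

    c≢0⇒∈ : ∀ {x} → c x ≢ 0ℚ → x ∈ C
    c≢0⇒∈ = nonzero⇒∈ (proj₁ (proj₂ (proj₁ circuit)))

    some-c≢0 : ∃ λ j → c j ≢ 0ℚ
    some-c≢0 = proj₁ (proj₂ (proj₂ (proj₁ circuit)))

    row : ∀ r → c (r ↑ˡ n) +ℚ rightSum n c * signColumn n r ≡ 0ℚ
    row r = trans (sym (rowSum n c r)) (proj₂ (proj₂ (proj₂ (proj₁ circuit))) r)

  rightSum≡0⇒left≡0 : rightSum n c ≡ 0ℚ → ∀ r → c (r ↑ˡ n) ≡ 0ℚ
  rightSum≡0⇒left≡0 s≡0 r = begin
    c (r ↑ˡ n)                                   ≡⟨ ℚᵖ.+-identityʳ _ ⟨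
    c (r ↑ˡ n) +ℚ 0ℚ                             ≡⟨ cong (c (r ↑ˡ n) +ℚ_) (ℚᵖ.*-zeroˡ (signColumn n r)) ⟨
    c (r ↑ˡ n) +ℚ 0ℚ * signColumn n r            ≡⟨ cong (λ s → c (r ↑ˡ n) +ℚ s * signColumn n r) s≡0 ⟨
    c (r ↑ˡ n) +ℚ rightSum n c * signColumn n r  ≡⟨ row r ⟩
    0ℚ                                           ∎
    where open ≡-Reasoning

  left≡0⇒rightSum≡0 : ∀ r → c (r ↑ˡ n) ≡ 0ℚ → rightSum n c ≡ 0ℚ
  left≡0⇒rightSum≡0 r c≡0 = *signPow≡0⇒≡0 (n ∸ suc (toℕ r)) (begin
    rightSum n c * signColumn n r                ≡⟨ ℚᵖ.+-identityˡ _ ⟨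
    0ℚ +ℚ rightSum n c * signColumn n r          ≡⟨ cong (_+ℚ rightSum n c * signColumn n r) c≡0 ⟨
    c (r ↑ˡ n) +ℚ rightSum n c * signColumn n r  ≡⟨ row r ⟩
    0ℚ                                           ∎)
    where open ≡-Reasoning

  rightSum≡0⇒≡rightPair : rightSum n c ≡ 0ℚ → ∃₂ λ a b → a ≢ b × C ≡ ⁅ n ↑ʳ a ⁆ ∪ ⁅ n ↑ʳ b ⁆
  rightSum≡0⇒≡rightPair s≡0 with some-c≢0
  ... | j₀ , c[j₀]≢0 with split n j₀
  ...   | left r = contradiction (rightSum≡0⇒left≡0 s≡0 r) c[j₀]≢0
  ...   | right a with sum≡0⇒∃≢0-elsewhere (c ∘ (n ↑ʳ_)) s≡0 c[j₀]≢0
  ...     | b , b≢a , c[b]≢0 =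
    a , b , b≢a ∘ sym , circuit⊇rightPair⇒≡ circuit (b≢a ∘ sym) (c≢0⇒∈ c[j₀]≢0) (c≢0⇒∈ c[b]≢0)

  rightSum≢0⇒≡firstHalf∪ : 1 ≤ n → rightSum n c ≢ 0ℚ → ∃ λ k → C ≡ firstHalf n ∪ ⁅ n ↑ʳ k ⁆
  rightSum≢0⇒≡firstHalf∪ 1≤n s≢0 with sum≢0⇒∃≢0 (c ∘ (n ↑ʳ_)) s≢0
  ... | k , c[k]≢0 = k , ⊆-antisym C⊆ (∪-⊆ firstHalf⊆C (⁅⁆-⊆ k∈C))
    where
    k∈C : n ↑ʳ k ∈ C
    k∈C = c≢0⇒∈ c[k]≢0
    left∈C : ∀ r → r ↑ˡ n ∈ C
    left∈C r = c≢0⇒∈ (s≢0 ∘ left≡0⇒rightSum≡0 r)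
    firstHalf⊆C : firstHalf n ⊆ C
    firstHalf⊆C {x} x∈ with split n x
    ... | left r   = left∈C r
    ... | right k′ = contradiction x∈ (↑ʳ∉firstHalf n k′)
    C⊆ : C ⊆ firstHalf n ∪ ⁅ n ↑ʳ k ⁆
    C⊆ {x} x∈C with split n x
    ... | left r = x∈p∪q⁺ (inj₁ (↑ˡ∈firstHalf n r))
    ... | right k′ with k′ Finᵖ.≟ k
    ...   | yes refl = x∈p∪q⁺ (inj₂ (x∈⁅x⁆ _))
    ...   | no k′≢k  = contradiction
      (subst (r₀ ↑ˡ n ∈_) (circuit⊇rightPair⇒≡ circuit k′≢k x∈C k∈C) (left∈C r₀))
      (↑ˡ∉⁅↑ʳ⁆∪⁅↑ʳ⁆ r₀ k′ k)
      where
      r₀ : Fin n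
      r₀ = fromℕ< 1≤n

lemma4p2 : (n : ℕ) → 1 ≤ n → (C : Subset (n + n)) → Circuit n C →
    (∃ λ (i : Fin (n + n)) → n ≤ toℕ i × C ≡ firstHalf n ∪ ⁅ i ⁆)
    ⊎ (∃₂ λ (i j : Fin (n + n)) → n ≤ toℕ i × n ≤ toℕ j × i ≢ j × C ≡ ⁅ i ⁆ ∪ ⁅ j ⁆)
lemma4p2 n 1≤n C circuit@((c , _) , _) with rightSum n c ℚᵖ.≟ 0ℚ
... | yes s≡0 with rightSum≡0⇒≡rightPair circuit s≡0
...   | a , b , a≢b , C≡pair =
  inj₂ (n ↑ʳ a , n ↑ʳ b , n≤toℕ-↑ʳ n a , n≤toℕ-↑ʳ n b , a≢b ∘ Finᵖ.↑ʳ-injective n a b , C≡pair)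
lemma4p2 n 1≤n C circuit | no s≢0 with rightSum≢0⇒≡firstHalf∪ circuit 1≤n s≢0
...   | k , C≡ = inj₁ (n ↑ʳ k , n≤toℕ-↑ʳ n k , C≡)
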